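{- Let $\mathsf{CS}$ be a constant specification. The canonical basic modular model $B^{can}=(W^{can},\leq^{can},*^{can})$ is a basic modular model (with respect to $\mathsf{CS}$), i.e., a factive basic evaluation.
   Context: Justification terms are built from countably many justification constants and countably many justification variables using the binary operations $\cdot$ and $+$ and the unary operation $!$. Formulas are built from a countable set $\mathsf{Prop}$ of atomic propositions and the constant $\bot$ using $\land, \lor, \rightarrow$, and the clause: if $A$ is a formula and $t$ a term, then $t:A$ is a formula. $\mathsf{Tm}$ denotes the set of terms. The axioms of $\mathsf{iJT4}$ are: all axioms of intuitionistic propositional logic (in this language); $t:(A\rightarrow B)\rightarrow(s:A\rightarrow (t\cdot s):B)$; $t:A\rightarrow (t+s):A$ and $s:A\rightarrow (t+s):A$; $t:A\rightarrow A$; $t:A\rightarrow\, !t:(t:A)$. A constant specification $\mathsf{CS}$ is a set of pairs $(c,A)$ with $c$ a constant and $A$ an axiom of $\mathsf{iJT4}$. $\mathsf{iJT4}_{\mathsf{CS}}$ is the Hilbert system with these axioms and the rules modus ponens and axiom necessitation (if $(c,A)\in\mathsf{CS}$, infer $c:A$). For a set of formulas $M$, $M\vdash A$ means that $A$ is derivable from the axioms and members of $M$ by modus ponens and axiom necessitation. A set of formulas $\Delta$ is prime if (i) $A\lor B\in\Delta$ implies $A\in\Delta$ or $B\in\Delta$; (ii) $\Delta\vdash A$ implies $A\in\Delta$; (iii) $\bot\notin\Delta$. For sets of formulas $X,Y$ and a term $s$ let $X\cdot Y := \{A \mid \exists B\in Y,\ (B\rightarrow A)\in X\}$ and $s:X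 := \{s:A \mid A\in X\}$. A basic evaluation is a tuple $(W,\leq,*)$ with $W\neq\varnothing$, $\leq$ a partial order on $W$, $*:\mathsf{Prop}\times W\to\{0,1\}$ and $*:\mathsf{Tm}\times W\to\mathcal{P}(\text{Formulas})$ (write $t^*_w$ for $*(t,w)$, $p^*_w$ for $*(p,w)$), such that for all $w\in W$, all terms $s,t$ and formulas $A$: (1) $s^*_w\cdot t^*_w\subseteq (s\cdot t)^*_w$; (2) $s^*_w\cup t^*_w\subseteq (s+t)^*_w$; (3) if $(t,A)\in\mathsf{CS}$ then $A\in t^*_w$; (4) $s:s^*_w\subseteq (!s)^*_w$; (M1) if $p^*_w=1$ and $w\leq v$ then $p^*_v=1$; (M2) if $w\leq v$ then $t^*_w\subseteq t^*_v$. Truth in a basic evaluation $\mathcal{M}$: $(\mathcal{M},w)\nvDash\bot$; $(\mathcal{M},w)\vDash p$ iff $p^*_w=1$; $\land,\lor$ are evaluated locally; $(\mathcal{M},w)\vDash A\rightarrow B$ iff for all $v\geq w$ with $(\mathcal{M},v)\vDash A$ we have $(\mathcal{M},v)\vDash B$; $(\mathcal{M},w)\vDash t:A$ iff $A\in t^*_w$. A basic evaluation is factive if $A\in t^*_w$ implies $(\mathcal{M},w)\vDash A$ for all $A,t,w$. A basic modular model is a factive basic evaluation. The canonical basic modular model is $B^{can}=(W^{can},\leq^{can},*^{can})$ where $W^{can}$ is the set of all prime sets, $\leq^{can}$ is set inclusion $\subseteq$, $*^{can}(p,\Delta)=1$ iff $p\in\Delta$, and $*^{can}(t,\Delta)=\{A\mid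 t:A\in\Delta\}$. -}

module Defs where

open import Level using (Level; _⊔_; Lift) renaming (suc to lsuc; zero to lzero)
open import Data.Nat using (ℕ)
open import Data.Empty using (⊥)
open import Data.Product using (Σ; _×_; _,_; proj₁)
open import Data.Sum using (_⊎_)
open import Relation.Nullary using (¬_)
open import Relation.Binary.PropositionalEquality using (_≡_)
open import Relation.Binary.Structures using (IsPartialOrder)

infixl 7 _·_
infixl 6 _+_
infix  8 !_

data Tm : Set where
  const : ℕ → Tm
  var   : ℕ → Tm
  _·_   : Tm → Tm → Tm
  _+_   : Tm → Tm → Tm
  !_    : Tm → Tm

infixr 5 _∶_
infixr 4 _∧_
infixr 3 _∨_
infixr 2 _⇒_

data Fm : Set where
  atom : ℕ → Fm
  ⊥f   : Fm
  _∧_  : Fm → Fm → Fm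
  _∨_  : Fm → Fm → Fm
  _⇒_  : Fm → Fm → Fm
  _∶_  : Tm → Fm → Fm

data Axiom : Fm → Set where
  K     : ∀ A B → Axiom (A ⇒ B ⇒ A)
  S     : ∀ A B C → Axiom ((A ⇒ B ⇒ C) ⇒ (A ⇒ B) ⇒ A ⇒ C)
  ∧E₁   : ∀ A B → Axiom (A ∧ B ⇒ A)
  ∧E₂   : ∀ A B → Axiom (A ∧ B ⇒ B)
  ∧I    : ∀ A B → Axiom (A ⇒ B ⇒ A ∧ B)
  ∨I₁   : ∀ A B → Axiom (A ⇒ A ∨ B)
  ∨I₂   : ∀ A B → Axiom (B ⇒ A ∨ B)
  ∨E    : ∀ A B C → Axiom ((A ⇒ C) ⇒ (B ⇒ C) ⇒ A ∨ B ⇒ C)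
  ⊥E    : ∀ A → Axiom (⊥f ⇒ A)
  appAx : ∀ t s A B → Axiom (t ∶ (A ⇒ B) ⇒ s ∶ A ⇒ (t · s) ∶ B)
  sumL  : ∀ t s A → Axiom (t ∶ A ⇒ (t + s) ∶ A)
  sumR  : ∀ t s A → Axiom (s ∶ A ⇒ (t + s) ∶ A)
  fact  : ∀ t A → Axiom (t ∶ A ⇒ A)
  pit   : ∀ t A → Axiom (t ∶ A ⇒ (! t) ∶ (t ∶ A))

FmSet : Set₁
FmSet = Fm → Set

record ConstSpec : Set₁ where
  field
    CS    : ℕ → Fm → Set
    CS-ax : ∀ c A → CS c A → Axiom A

open ConstSpec public

data Deriv (𝒞 : ConstSpec) (M : FmSet) : Fm → Set where
  ax  : ∀ {A} → Axiom A → Deriv 𝒞 M A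
  hyp : ∀ {A} → M A → Deriv 𝒞 M A
  mp  : ∀ {A B} → Deriv 𝒞 M (A ⇒ B) → Deriv 𝒞 M A → Deriv 𝒞 M B
  nec : ∀ {c A} → CS 𝒞 c A → Deriv 𝒞 M (const c ∶ A)

infix 1 _∣_⊢_
_∣_⊢_ : ConstSpec → FmSet → Fm → Set
𝒞 ∣ M ⊢ A = Deriv 𝒞 M A

record Prime (𝒞 : ConstSpec) (Δ : FmSet) : Set where
  field
    disj   : ∀ A B → Δ (A ∨ B) → Δ A ⊎ Δ B
    closed : ∀ A → 𝒞 ∣ Δ ⊢ A → Δ A
    cons   : ¬ Δ ⊥f

_⊆_ : FmSet → FmSet → Set
X ⊆ Y = ∀ A → X A → Y A

-- Since membership in sets of formulas is a
-- proposition (not decidable constructively), p*_w ∈ {0,1} is represented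
-- by a proposition  pstar p w  ("p*_w = 1").

record EvalData (a ℓ : Level) : Set (lsuc (a ⊔ ℓ)) where
  field
    W     : Set a
    _≈_   : W → W → Set ℓ
    _≤_   : W → W → Set ℓ
    pstar : ℕ → W → Set ℓ
    tstar : Tm → W → Fm → Set ℓ    -- A ∈ t*_w

record IsBasicEvaluation {a ℓ} (𝒞 : ConstSpec) (E : EvalData a ℓ) : Set (a ⊔ ℓ) where
  open EvalData E
  field
    nonempty : W
    partial  : IsPartialOrder _≈_ _≤_
    app  : ∀ w s t A B → tstar s w (B ⇒ A) → tstar t w B → tstar (s · t) w A
    sumˡ : ∀ w s t A → tstar s w A → tstar (s + t) w A
    sumʳ : ∀ w s t A → tstar t w A → tstar (s + t) w A
    csp  : ∀ w c A → CS 𝒞 c A → tstar (const c) w A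
    bang : ∀ w s A → tstar s w A → tstar (! s) w (s ∶ A)
    M1   : ∀ p w v → pstar p w → w ≤ v → pstar p v
    M2   : ∀ t w v A → w ≤ v → tstar t w A → tstar t v A

module _ {a ℓ} (E : EvalData a ℓ) where
  open EvalData E

  _⊨_ : W → Fm → Set (a ⊔ ℓ)
  w ⊨ atom p  = Lift a (pstar p w)
  w ⊨ ⊥f      = Lift (a ⊔ ℓ) ⊥
  w ⊨ (A ∧ B) = (w ⊨ A) × (w ⊨ B)
  w ⊨ (A ∨ B) = (w ⊨ A) ⊎ (w ⊨ B)
  w ⊨ (A ⇒ B) = ∀ v → w ≤ v → v ⊨ A → v ⊨ B
  w ⊨ (t ∶ A) = Lift a (tstar t w A)

  Factive : Set (a ⊔ ℓ)
  Factive = ∀ t w A → tstar t w A → w ⊨ A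

IsBasicModularModel : ∀ {a ℓ} → ConstSpec → EvalData a ℓ → Set (a ⊔ ℓ)
IsBasicModularModel 𝒞 E = IsBasicEvaluation 𝒞 E × Factive E

PrimeSet : ConstSpec → Set₁
PrimeSet 𝒞 = Σ FmSet (Prime 𝒞)

Bcan : ConstSpec → EvalData (lsuc lzero) lzero
Bcan 𝒞 = record
  { W     = PrimeSet 𝒞
  ; _≈_   = λ Δ Γ → (proj₁ Δ ⊆ proj₁ Γ) × (proj₁ Γ ⊆ proj₁ Δ)
  ; _≤_   = λ Δ Γ → proj₁ Δ ⊆ proj₁ Γ
  ; pstar = λ p Δ → proj₁ Δ (atom p)
  ; tstar = λ t Δ A → proj₁ Δ (t ∶ A)
  }

-- B^can is the Kripke model of prime theories, so everything rests on the truth lemma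
-- Δ ⊨ A ⇔ A ∈ Δ.  Each closure condition on * is closure of a prime set under one of the
-- justification axioms, and factivity is closure under t:A → A followed by the truth lemma.
-- The one substantial case of the truth lemma is A → B ∉ Δ: there Δ ∪ {A} does not derive B,
-- and a Lindenbaum construction along an enumeration of the formulas, with excluded middle
-- deciding at each stage whether the next formula can be added, extends it to a prime set
-- avoiding B.
module Submission where

open import Defs
open import Level using (0ℓ; lift; lower)
open import Axiom.ExcludedMiddle using (ExcludedMiddle)
open import Data.Nat using (ℕ; zero; suc; _*_; _≤_; _≤′_; ≤′-refl; ≤′-step; _⊔_)
open import Data.Nat.Properties using (suc-injective; *-cancelˡ-≡; even≢odd; ≤⇒≤′; m≤m⊔n; m≤n⊔m)
open import Data.Empty using (⊥; ⊥-elim)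
open import Data.Product using (Σ-syntax; ∃-syntax; _×_; _,_; proj₁; proj₂)
open import Data.Sum using (_⊎_; inj₁; inj₂; [_,_])
open import Function using (id; _∘_)
open import Relation.Nullary using (¬_; yes; no)
open import Relation.Binary.PropositionalEquality using (_≡_; refl; sym; trans; cong; cong₂; module ≡-Reasoning)
open import Relation.Binary.Structures using (IsPartialOrder)

-- Formulas are coded through binary trees: injectivity then follows from the left inverse
-- Tree→Fm, without comparing pairs of distinct constructors.
data Tree : Set where
  leaf : ℕ → Tree
  node : Tree → Tree → Tree

Tm→Tree : Tm → Tree
Tm→Tree (const n) = node (leaf 0) (leaf n)
Tm→Tree (var n)   = node (leaf 1) (leaf n)
Tm→Tree (s · t)   = node (leaf 2) (node (Tm→Tree s) (Tm→Tree t))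
Tm→Tree (s + t)   = node (leaf 3) (node (Tm→Tree s) (Tm→Tree t))
Tm→Tree (! t)     = node (leaf 4) (Tm→Tree t)

Tree→Tm : Tree → Tm
Tree→Tm (node (leaf 0) (leaf n))   = const n
Tree→Tm (node (leaf 1) (leaf n))   = var n
Tree→Tm (node (leaf 2) (node s t)) = Tree→Tm s · Tree→Tm t
Tree→Tm (node (leaf 3) (node s t)) = Tree→Tm s + Tree→Tm t
Tree→Tm (node (leaf 4) t)          = ! Tree→Tm t
Tree→Tm _                          = const 0

Tree→Tm∘Tm→Tree : ∀ t → Tree→Tm (Tm→Tree t) ≡ t
Tree→Tm∘Tm→Tree (const n) = refl
Tree→Tm∘Tm→Tree (var n)   = refl
Tree→Tm∘Tm→Tree (s · t)   = cong₂ _·_ (Tree→Tm∘Tm→Tree s) (Tree→Tm∘Tm→Tree t)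
Tree→Tm∘Tm→Tree (s + t)   = cong₂ _+_ (Tree→Tm∘Tm→Tree s) (Tree→Tm∘Tm→Tree t)
Tree→Tm∘Tm→Tree (! t)     = cong !_ (Tree→Tm∘Tm→Tree t)

Fm→Tree : Fm → Tree
Fm→Tree (atom n) = node (leaf 0) (leaf n)
Fm→Tree ⊥f       = leaf 0
Fm→Tree (A ∧ B)  = node (leaf 1) (node (Fm→Tree A) (Fm→Tree B))
Fm→Tree (A ∨ B)  = node (leaf 2) (node (Fm→Tree A) (Fm→Tree B))
Fm→Tree (A ⇒ B)  = node (leaf 3) (node (Fm→Tree A) (Fm→Tree B))
Fm→Tree (t ∶ A)  = node (leaf 4) (node (Tm→Tree t) (Fm→Tree A))

Tree→Fm : Tree → Fm
Tree→Fm (node (leaf 0) (leaf n))   = atom n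
Tree→Fm (node (leaf 1) (node A B)) = Tree→Fm A ∧ Tree→Fm B
Tree→Fm (node (leaf 2) (node A B)) = Tree→Fm A ∨ Tree→Fm B
Tree→Fm (node (leaf 3) (node A B)) = Tree→Fm A ⇒ Tree→Fm B
Tree→Fm (node (leaf 4) (node t A)) = Tree→Tm t ∶ Tree→Fm A
Tree→Fm _                          = ⊥f

Tree→Fm∘Fm→Tree : ∀ A → Tree→Fm (Fm→Tree A) ≡ A
Tree→Fm∘Fm→Tree (atom n) = refl
Tree→Fm∘Fm→Tree ⊥f       = refl
Tree→Fm∘Fm→Tree (A ∧ B)  = cong₂ _∧_ (Tree→Fm∘Fm→Tree A) (Tree→Fm∘Fm→Tree B)
Tree→Fm∘Fm→Tree (A ∨ B)  = cong₂ _∨_ (Tree→Fm∘Fm→Tree A) (Tree→Fm∘Fm→Tree B)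
Tree→Fm∘Fm→Tree (A ⇒ B)  = cong₂ _⇒_ (Tree→Fm∘Fm→Tree A) (Tree→Fm∘Fm→Tree B)
Tree→Fm∘Fm→Tree (t ∶ A)  = cong₂ _∶_ (Tree→Tm∘Tm→Tree t) (Tree→Fm∘Fm→Tree A)

pair : ℕ → ℕ → ℕ
pair zero    b = 2 * b
pair (suc a) b = suc (2 * pair a b)

pair-injective : ∀ a b a′ b′ → pair a b ≡ pair a′ b′ → a ≡ a′ × b ≡ b′
pair-injective zero    b zero     b′ e = refl , *-cancelˡ-≡ _ _ 2 e
pair-injective zero    b (suc a′) b′ e = ⊥-elim (even≢odd b (pair a′ b′) e)
pair-injective (suc a) b zero     b′ e = ⊥-elim (even≢odd b′ (pair a b) (sym e))
pair-injective (suc a) b (suc a′) b′ e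
  with refl , b≡b′ ← pair-injective a b a′ b′ (*-cancelˡ-≡ _ _ 2 (suc-injective e))
  = refl , b≡b′

Tree→ℕ : Tree → ℕ
Tree→ℕ (leaf n)   = pair 0 n
Tree→ℕ (node l r) = pair (suc (Tree→ℕ l)) (Tree→ℕ r)

Tree→ℕ-injective : ∀ x y → Tree→ℕ x ≡ Tree→ℕ y → x ≡ y
Tree→ℕ-injective (leaf m) (leaf n) e = cong leaf (proj₂ (pair-injective 0 m 0 n e))
Tree→ℕ-injective (leaf m) (node l r) e
  with () ← proj₁ (pair-injective 0 m (suc (Tree→ℕ l)) (Tree→ℕ r) e)
Tree→ℕ-injective (node l r) (leaf n) e
  with () ← proj₁ (pair-injective (suc (Tree→ℕ l)) (Tree→ℕ r) 0 n e)
Tree→ℕ-injective (node l r) (node l′ r′) e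
  with l≡l′ , r≡r′ ← pair-injective (suc (Tree→ℕ l)) (Tree→ℕ r) (suc (Tree→ℕ l′)) (Tree→ℕ r′) e
  = cong₂ node (Tree→ℕ-injective l l′ (suc-injective l≡l′)) (Tree→ℕ-injective r r′ r≡r′)

code : Fm → ℕ
code = Tree→ℕ ∘ Fm→Tree

code-injective : ∀ {A B} → code A ≡ code B → A ≡ B
code-injective {A} {B} e = begin
  A                    ≡⟨ sym (Tree→Fm∘Fm→Tree A) ⟩
  Tree→Fm (Fm→Tree A)  ≡⟨ cong Tree→Fm (Tree→ℕ-injective (Fm→Tree A) (Fm→Tree B) e) ⟩
  Tree→Fm (Fm→Tree B)  ≡⟨ Tree→Fm∘Fm→Tree B ⟩
  B                    ∎
  where open ≡-Reasoning

infixl 25 _∪｛_｝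

_∪｛_｝ : FmSet → Fm → FmSet
(M ∪｛ A ｝) B = M B ⊎ B ≡ A

module Derivability (𝒞 : ConstSpec) where

  weaken : ∀ {M N A} → M ⊆ N → 𝒞 ∣ M ⊢ A → 𝒞 ∣ N ⊢ A
  weaken M⊆N (ax a)   = ax a
  weaken M⊆N (hyp h)  = hyp (M⊆N _ h)
  weaken M⊆N (mp d e) = mp (weaken M⊆N d) (weaken M⊆N e)
  weaken M⊆N (nec c)  = nec c

  ⊢A⇒A : ∀ {M} A → 𝒞 ∣ M ⊢ A ⇒ A
  ⊢A⇒A A = mp (mp (ax (S A (A ⇒ A) A)) (ax (K A (A ⇒ A)))) (ax (K A A))

  deduction : ∀ {M A B} → 𝒞 ∣ M ∪｛ A ｝ ⊢ B → 𝒞 ∣ M ⊢ A ⇒ B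
  deduction {A = A} {B} (ax a)            = mp (ax (K B A)) (ax a)
  deduction {A = A} {B} (hyp (inj₁ h))    = mp (ax (K B A)) (hyp h)
  deduction {A = A}     (hyp (inj₂ refl)) = ⊢A⇒A A
  deduction {A = A} {B} (mp {C} d e)      = mp (mp (ax (S A C B)) (deduction d)) (deduction e)
  deduction {A = A} {B} (nec c)           = mp (ax (K B A)) (nec c)

⟦_⟧ : Fm → Set
⟦ atom _ ⟧ = ⊥
⟦ ⊥f ⟧     = ⊥
⟦ A ∧ B ⟧  = ⟦ A ⟧ × ⟦ B ⟧
⟦ A ∨ B ⟧  = ⟦ A ⟧ ⊎ ⟦ B ⟧
⟦ A ⇒ B ⟧  = ⟦ A ⟧ → ⟦ B ⟧
⟦ _ ∶ A ⟧  = ⟦ A ⟧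

⟦⟧-axiom : ∀ {A} → Axiom A → ⟦ A ⟧
⟦⟧-axiom (K _ _)         = λ a _ → a
⟦⟧-axiom (S _ _ _)       = λ f g a → f a (g a)
⟦⟧-axiom (∧E₁ _ _)       = proj₁
⟦⟧-axiom (∧E₂ _ _)       = proj₂
⟦⟧-axiom (∧I _ _)        = _,_
⟦⟧-axiom (∨I₁ _ _)       = inj₁
⟦⟧-axiom (∨I₂ _ _)       = inj₂
⟦⟧-axiom (∨E _ _ _)      = λ f g → [ f , g ]
⟦⟧-axiom (⊥E _)          = ⊥-elim
⟦⟧-axiom (appAx _ _ _ _) = id
⟦⟧-axiom (sumL _ _ _)    = id
⟦⟧-axiom (sumR _ _ _)    = id
⟦⟧-axiom (fact _ _)      = id
⟦⟧-axiom (pit _ _)       = id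

⟦⟧-sound : ∀ 𝒞 {A} → 𝒞 ∣ ⟦_⟧ ⊢ A → ⟦ A ⟧
⟦⟧-sound 𝒞 (ax a)          = ⟦⟧-axiom a
⟦⟧-sound 𝒞 (hyp h)         = h
⟦⟧-sound 𝒞 (mp d e)        = ⟦⟧-sound 𝒞 d (⟦⟧-sound 𝒞 e)
⟦⟧-sound 𝒞 (nec {c} {A} x) = ⟦⟧-axiom (CS-ax 𝒞 c A x)

⟦⟧-prime : ∀ 𝒞 → Prime 𝒞 ⟦_⟧
⟦⟧-prime 𝒞 = record
  { disj   = λ _ _ → id
  ; closed = λ _ → ⟦⟧-sound 𝒞
  ; cons   = id
  }

module Lindenbaum (em : ExcludedMiddle 0ℓ) (𝒞 : ConstSpec)
                  (Σ₀ : FmSet) (B : Fm) (Σ₀⊬B : ¬ (𝒞 ∣ Σ₀ ⊢ B)) where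
  open Derivability 𝒞

  stage : ℕ → FmSet
  stage zero      = Σ₀
  stage (suc n) ψ = stage n ψ ⊎ (code ψ ≡ n × ¬ (𝒞 ∣ stage n ∪｛ ψ ｝ ⊢ B))

  Γ : FmSet
  Γ ψ = ∃[ n ] stage n ψ

  stage-mono′ : ∀ {m n} → m ≤′ n → stage m ⊆ stage n
  stage-mono′ ≤′-refl       _ h = h
  stage-mono′ (≤′-step m≤n) _ h = inj₁ (stage-mono′ m≤n _ h)

  stage-mono : ∀ {m n} → m ≤ n → stage m ⊆ stage n
  stage-mono = stage-mono′ ∘ ≤⇒≤′

  ⊢-compact : ∀ {A} → 𝒞 ∣ Γ ⊢ A → ∃[ n ] (𝒞 ∣ stage n ⊢ A)
  ⊢-compact (ax a)        = 0 , ax a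
  ⊢-compact (hyp (n , h)) = n , hyp h
  ⊢-compact (nec c)       = 0 , nec c
  ⊢-compact (mp d e) with ⊢-compact d | ⊢-compact e
  ... | m , d′ | n , e′ =
    m ⊔ n , mp (weaken (stage-mono (m≤m⊔n m n)) d′) (weaken (stage-mono (m≤n⊔m m n)) e′)

  stage⊬B : ∀ n → ¬ (𝒞 ∣ stage n ⊢ B)
  stage⊬B zero = Σ₀⊬B
  stage⊬B (suc n) d with em {Σ[ ψ ∈ Fm ] code ψ ≡ n × ¬ (𝒞 ∣ stage n ∪｛ ψ ｝ ⊢ B)}
  ... | yes (ψ , codeψ , ψ⊬B) = ψ⊬B (weaken added d)
    where
    added : stage (suc n) ⊆ stage n ∪｛ ψ ｝
    added _ (inj₁ h)           = inj₁ h
    added χ (inj₂ (codeχ , _)) = inj₂ (code-injective (trans codeχ (sym codeψ)))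
  ... | no nothing-added = stage⊬B n (weaken unchanged d)
    where
    unchanged : stage (suc n) ⊆ stage n
    unchanged _ (inj₁ h)         = h
    unchanged χ (inj₂ (c , χ⊬B)) = ⊥-elim (nothing-added (χ , c , χ⊬B))

  Γ⊬B : ¬ (𝒞 ∣ Γ ⊢ B)
  Γ⊬B d = let n , d′ = ⊢-compact d in stage⊬B n d′

  ∉Γ⇒Γ⊢C⇒B : ∀ {C} → ¬ Γ C → 𝒞 ∣ Γ ⊢ C ⇒ B
  ∉Γ⇒Γ⊢C⇒B {C} C∉Γ with em {𝒞 ∣ stage (code C) ∪｛ C ｝ ⊢ B}
  ... | yes d  = weaken (λ _ h → code C , h) (deduction d)
  ... | no C⊬B = ⊥-elim (C∉Γ (suc (code C) , inj₂ (refl , C⊬B)))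

  Γ-closed : ∀ C → 𝒞 ∣ Γ ⊢ C → Γ C
  Γ-closed C d with em {Γ C}
  ... | yes C∈Γ = C∈Γ
  ... | no C∉Γ  = ⊥-elim (Γ⊬B (mp (∉Γ⇒Γ⊢C⇒B C∉Γ) d))

  Γ-disj : ∀ C D → Γ (C ∨ D) → Γ C ⊎ Γ D
  Γ-disj C D C∨D∈Γ with em {Γ C} | em {Γ D}
  ... | yes C∈Γ | _       = inj₁ C∈Γ
  ... | no _    | yes D∈Γ = inj₂ D∈Γ
  ... | no C∉Γ  | no D∉Γ  =
    ⊥-elim (Γ⊬B (mp (mp (mp (ax (∨E C D B)) (∉Γ⇒Γ⊢C⇒B C∉Γ)) (∉Γ⇒Γ⊢C⇒B D∉Γ)) (hyp C∨D∈Γ)))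

  Γ-prime : Prime 𝒞 Γ
  Γ-prime = record
    { disj   = Γ-disj
    ; closed = Γ-closed
    ; cons   = λ ⊥∈Γ → Γ⊬B (mp (ax (⊥E B)) (hyp ⊥∈Γ))
    }

lindenbaum : ExcludedMiddle 0ℓ → ∀ 𝒞 {Σ₀ B} → ¬ (𝒞 ∣ Σ₀ ⊢ B) →
             Σ[ Δ ∈ PrimeSet 𝒞 ] Σ₀ ⊆ proj₁ Δ × ¬ proj₁ Δ B
lindenbaum em 𝒞 {Σ₀} {B} Σ₀⊬B =
  (Γ , Γ-prime) , (λ _ h → 0 , h) , (λ B∈Γ → Γ⊬B (hyp B∈Γ))
  where open Lindenbaum em 𝒞 Σ₀ B Σ₀⊬B

module _ (𝒞 : ConstSpec) where

  ∈-closed : ∀ (Δ : PrimeSet 𝒞) {A} → 𝒞 ∣ proj₁ Δ ⊢ A → proj₁ Δ A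
  ∈-closed (_ , Δ-prime) = Prime.closed Δ-prime _

  ⊆-isPartialOrder : IsPartialOrder (EvalData._≈_ (Bcan 𝒞)) (EvalData._≤_ (Bcan 𝒞))
  ⊆-isPartialOrder = record
    { isPreorder = record
      { isEquivalence = record
        { refl  = (λ _ → id) , (λ _ → id)
        ; sym   = λ (Δ⊆Γ , Γ⊆Δ) → Γ⊆Δ , Δ⊆Γ
        ; trans = λ (Δ⊆Γ , Γ⊆Δ) (Γ⊆Θ , Θ⊆Γ) → (λ A → Γ⊆Θ A ∘ Δ⊆Γ A) , (λ A → Γ⊆Δ A ∘ Θ⊆Γ A)
        }
      ; reflexive = proj₁
      ; trans     = λ Δ⊆Γ Γ⊆Θ A → Γ⊆Θ A ∘ Δ⊆Γ A
      }
    ; antisym = _,_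
    }

  Bcan-isBasicEvaluation : IsBasicEvaluation 𝒞 (Bcan 𝒞)
  Bcan-isBasicEvaluation = record
    { nonempty = ⟦_⟧ , ⟦⟧-prime 𝒞
    ; partial  = ⊆-isPartialOrder
    ; app      = λ Δ s t A B s∶B⇒A t∶B →
                   ∈-closed Δ (mp (mp (ax (appAx s t B A)) (hyp s∶B⇒A)) (hyp t∶B))
    ; sumˡ     = λ Δ s t A s∶A → ∈-closed Δ (mp (ax (sumL s t A)) (hyp s∶A))
    ; sumʳ     = λ Δ s t A t∶A → ∈-closed Δ (mp (ax (sumR s t A)) (hyp t∶A))
    ; csp      = λ Δ c A cA∈CS → ∈-closed Δ (nec cA∈CS)
    ; bang     = λ Δ s A s∶A → ∈-closed Δ (mp (ax (pit s A)) (hyp s∶A))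
    ; M1       = λ p Δ Γ p∈Δ Δ⊆Γ → Δ⊆Γ _ p∈Δ
    ; M2       = λ t Δ Γ A Δ⊆Γ t∶A∈Δ → Δ⊆Γ _ t∶A∈Δ
    }

module TruthLemma (em : ExcludedMiddle 0ℓ) (𝒞 : ConstSpec) where
  open Derivability 𝒞

  infix 4 _⊩_
  _⊩_ : PrimeSet 𝒞 → Fm → Set₁
  _⊩_ = _⊨_ (Bcan 𝒞)

  mutual
    ∈⇒⊩ : ∀ A (Δ : PrimeSet 𝒞) → proj₁ Δ A → Δ ⊩ A
    ∈⇒⊩ (atom p) Δ p∈Δ   = lift p∈Δ
    ∈⇒⊩ ⊥f       Δ ⊥∈Δ   = ⊥-elim (Prime.cons (proj₂ Δ) ⊥∈Δ)
    ∈⇒⊩ (A ∧ B)  Δ A∧B∈Δ =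
      ∈⇒⊩ A Δ (∈-closed 𝒞 Δ (mp (ax (∧E₁ A B)) (hyp A∧B∈Δ))) ,
      ∈⇒⊩ B Δ (∈-closed 𝒞 Δ (mp (ax (∧E₂ A B)) (hyp A∧B∈Δ)))
    ∈⇒⊩ (A ∨ B)  Δ A∨B∈Δ with Prime.disj (proj₂ Δ) A B A∨B∈Δ
    ... | inj₁ A∈Δ = inj₁ (∈⇒⊩ A Δ A∈Δ)
    ... | inj₂ B∈Δ = inj₂ (∈⇒⊩ B Δ B∈Δ)
    ∈⇒⊩ (A ⇒ B)  Δ A⇒B∈Δ Γ Δ⊆Γ Γ⊩A =
      ∈⇒⊩ B Γ (∈-closed 𝒞 Γ (mp (hyp (Δ⊆Γ _ A⇒B∈Δ)) (hyp (⊩⇒∈ A Γ Γ⊩A))))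
    ∈⇒⊩ (t ∶ A)  Δ t∶A∈Δ = lift t∶A∈Δ

    ⊩⇒∈ : ∀ A (Δ : PrimeSet 𝒞) → Δ ⊩ A → proj₁ Δ A
    ⊩⇒∈ (atom p) Δ Δ⊩p        = lower Δ⊩p
    ⊩⇒∈ ⊥f       Δ Δ⊩⊥        = ⊥-elim (lower Δ⊩⊥)
    ⊩⇒∈ (A ∧ B)  Δ (Δ⊩A , Δ⊩B) =
      ∈-closed 𝒞 Δ (mp (mp (ax (∧I A B)) (hyp (⊩⇒∈ A Δ Δ⊩A))) (hyp (⊩⇒∈ B Δ Δ⊩B)))
    ⊩⇒∈ (A ∨ B)  Δ (inj₁ Δ⊩A) = ∈-closed 𝒞 Δ (mp (ax (∨I₁ A B)) (hyp (⊩⇒∈ A Δ Δ⊩A)))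
    ⊩⇒∈ (A ∨ B)  Δ (inj₂ Δ⊩B) = ∈-closed 𝒞 Δ (mp (ax (∨I₂ A B)) (hyp (⊩⇒∈ B Δ Δ⊩B)))
    ⊩⇒∈ (A ⇒ B)  Δ Δ⊩A⇒B with em {proj₁ Δ (A ⇒ B)}
    ... | yes A⇒B∈Δ = A⇒B∈Δ
    ... | no A⇒B∉Δ
      with Γ , Δ∪A⊆Γ , B∉Γ ← lindenbaum em 𝒞 (A⇒B∉Δ ∘ ∈-closed 𝒞 Δ ∘ deduction)
      = ⊥-elim (B∉Γ (⊩⇒∈ B Γ (Δ⊩A⇒B Γ (λ C → Δ∪A⊆Γ C ∘ inj₁) (∈⇒⊩ A Γ (Δ∪A⊆Γ A (inj₂ refl))))))
    ⊩⇒∈ (t ∶ A)  Δ Δ⊩t∶A = lower Δ⊩t∶A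

  Bcan-factive : Factive (Bcan 𝒞)
  Bcan-factive t Δ A t∶A∈Δ = ∈⇒⊩ A Δ (∈-closed 𝒞 Δ (mp (ax (fact t A)) (hyp t∶A∈Δ)))

mainTheorem8 : ExcludedMiddle 0ℓ → (𝒞 : ConstSpec) → IsBasicModularModel 𝒞 (Bcan 𝒞)
mainTheorem8 em 𝒞 = Bcan-isBasicEvaluation 𝒞 , TruthLemma.Bcan-factive em 𝒞
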